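{- Let $\mathcal{B}$ be a tame cartesian bicategory and $\mathcal{S}$ the class of surjective maps of $\mathcal{B}$. Then: $\mathcal{S}$ contains all identities; $\mathcal{S}$ is closed under composition; $\mathcal{S}$ is closed under products (if $\pi_1,\pi_2\in\mathcal{S}$ then $\pi_1\otimes\pi_2\in\mathcal{S}$); $\mathcal{S}$ is closed under weak pullback (if $f;\pi=\tau;k$ is a weak pullback square in $\mathrm{Map}(\mathcal{B})$ with $f\colon A\to B$, $\pi\colon B\to D$, $\tau\colon A\to C$, $k\colon C\to D$ and $\pi\in\mathcal{S}$, then $\tau\in\mathcal{S}$); and for maps $f,\pi$, if $f;\pi\in\mathcal{S}$ then $\pi\in\mathcal{S}$.
   Context: Composition is diagrammatic ($R;S$ means first $R$ then $S$). A cartesian bicategory is a (strict) symmetric monoidal category $(\mathcal{B},\otimes,I)$ with symmetry $\sigma$, enriched over posets (hom-sets ordered by $\le$, with $;$ and $\otimes$ monotone), where every object $X$ has $\delta_X\colon X\to X\otimes X$, $\varepsilon_X\colon X\to I$ such that: (1) they form a cocommutative comonoid; (2) they have right adjoints $\delta_X^*,\varepsilon_X^*$: $\mathrm{id}_X\le\delta_X;\delta_X^*$, $\delta_X^*;\delta_X\le\mathrm{id}$, $\mathrm{id}_X\le\varepsilon_X;\varepsilon_X^*$, $\varepsilon_X^*;\varepsilon_X\le\mathrm{id}_I$; (3) $\delta_X^*;\delta_X=(\mathrm{id}_X\otimes\delta_X);(\delta_X^*\otimes\mathrm{id}_X)$; (4) every $R\colon X\to Y$ satisfies $R;\delta_Y\le\delta_X;(R\otimes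 R)$ and $R;\varepsilon_Y\le\varepsilon_X$; (5) $\varepsilon_{X\otimes Y}=\varepsilon_X\otimes\varepsilon_Y$, $\delta_{X\otimes Y}=(\delta_X\otimes\delta_Y);(\mathrm{id}\otimes\sigma_{X,Y}\otimes\mathrm{id})$, $\varepsilon_I=\delta_I=\mathrm{id}_I$. $R^{op}=(\mathrm{id}_Y\otimes(\varepsilon_X^*;\delta_X));(\mathrm{id}_Y\otimes R\otimes\mathrm{id}_X);((\delta_Y^*;\varepsilon_Y)\otimes\mathrm{id}_X)$. $R\colon X\to Y$ is surjective if $\varepsilon_Y^*\le\varepsilon_X^*;R$. A map is a morphism $f$ with $\delta_X;(f\otimes f)\le f;\delta_Y$ and $\varepsilon_X\le f;\varepsilon_Y$; $\mathrm{Map}(\mathcal{B})$ is the subcategory of maps. Enough maps: for every $R\colon X\to I$ there is a map $f\colon Z\to X$ with $R=f^{op};\varepsilon_Z$. A weak pullback is a commutative square satisfying the existence (not necessarily uniqueness) part of the pullback universal property. $\mathcal{B}$ is tame if it has enough maps and for all maps $f\colon A\to B$, $g\colon A\to C$, $h\colon B\to D$, $k\colon C\to D$: $h;k^{op}=f^{op};g$ iff the square $f;h=g;k$ is a weak pullback in $\mathrm{Map}(\mathcal{B})$. -}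

module Defs where

open import Level using (Level; _⊔_; suc)
open import Relation.Binary.PropositionalEquality using (_≡_; refl; sym; trans; cong; subst)
open import Data.Product using (Σ; _×_; _,_)
open import Function.Bundles using (_⇔_)

-- Identity-transport along an equality of objects (used to express strictness:
-- in a strict monoidal category, e.g. (X⊗Y)⊗Z and X⊗(Y⊗Z) are equal objects,
-- and the paper silently identifies them; we insert these casts explicitly).
castWith : ∀ {o ℓ} {O : Set o} (H : O → O → Set ℓ) (idm : ∀ X → H X X)
         → ∀ {X Y} → X ≡ Y → H X Y
castWith H idm {X} p = subst (H X) p (idm X)

record CartesianBicategory (o ℓ e : Level) : Set (suc (o ⊔ ℓ ⊔ e)) where
  infixr 9 _⨾_
  infixr 10 _⊗₀_ _⊗₁_
  infix 4 _≤_
  field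
    Obj   : Set o
    Obj-isSet : ∀ {X Y : Obj} (p q : X ≡ Y) → p ≡ q
    _⇒_   : Obj → Obj → Set ℓ
    id    : ∀ X → X ⇒ X
    _⨾_   : ∀ {X Y Z} → X ⇒ Y → Y ⇒ Z → X ⇒ Z
    ⨾-assoc : ∀ {W X Y Z} (R : W ⇒ X) (S : X ⇒ Y) (T : Y ⇒ Z) → (R ⨾ S) ⨾ T ≡ R ⨾ (S ⨾ T)
    ⨾-idˡ : ∀ {X Y} (R : X ⇒ Y) → id X ⨾ R ≡ R
    ⨾-idʳ : ∀ {X Y} (R : X ⇒ Y) → R ⨾ id Y ≡ R
    _≤_   : ∀ {X Y} → X ⇒ Y → X ⇒ Y → Set e
    ≤-refl    : ∀ {X Y} {R : X ⇒ Y} → R ≤ R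
    ≤-trans   : ∀ {X Y} {R S T : X ⇒ Y} → R ≤ S → S ≤ T → R ≤ T
    ≤-antisym : ∀ {X Y} {R S : X ⇒ Y} → R ≤ S → S ≤ R → R ≡ S
    ⨾-mono : ∀ {X Y Z} {R R' : X ⇒ Y} {S S' : Y ⇒ Z} → R ≤ R' → S ≤ S' → R ⨾ S ≤ R' ⨾ S'
    _⊗₀_  : Obj → Obj → Obj
    I     : Obj
    _⊗₁_  : ∀ {X Y X' Y'} → X ⇒ Y → X' ⇒ Y' → (X ⊗₀ X') ⇒ (Y ⊗₀ Y')
    ⊗-id  : ∀ X Y → id X ⊗₁ id Y ≡ id (X ⊗₀ Y)
    ⊗-interchange : ∀ {X Y Z X' Y' Z'} (R : X ⇒ Y) (S : Y ⇒ Z) (R' : X' ⇒ Y') (S' : Y' ⇒ Z')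
                  → (R ⨾ S) ⊗₁ (R' ⨾ S') ≡ (R ⊗₁ R') ⨾ (S ⊗₁ S')
    ⊗-mono : ∀ {X Y X' Y'} {R S : X ⇒ Y} {R' S' : X' ⇒ Y'} → R ≤ S → R' ≤ S' → R ⊗₁ R' ≤ S ⊗₁ S'
    ⊗-assoc₀ : ∀ X Y Z → (X ⊗₀ Y) ⊗₀ Z ≡ X ⊗₀ (Y ⊗₀ Z)
    ⊗-unitˡ₀ : ∀ X → I ⊗₀ X ≡ X
    ⊗-unitʳ₀ : ∀ X → X ⊗₀ I ≡ X
    ⊗-assoc₁ : ∀ {X Y Z X' Y' Z'} (R : X ⇒ X') (S : Y ⇒ Y') (T : Z ⇒ Z')
             → ((R ⊗₁ S) ⊗₁ T) ⨾ castWith _⇒_ id (⊗-assoc₀ X' Y' Z')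
               ≡ castWith _⇒_ id (⊗-assoc₀ X Y Z) ⨾ (R ⊗₁ (S ⊗₁ T))
    ⊗-unitˡ₁ : ∀ {X Y} (R : X ⇒ Y)
             → (id I ⊗₁ R) ⨾ castWith _⇒_ id (⊗-unitˡ₀ Y) ≡ castWith _⇒_ id (⊗-unitˡ₀ X) ⨾ R
    ⊗-unitʳ₁ : ∀ {X Y} (R : X ⇒ Y)
             → (R ⊗₁ id I) ⨾ castWith _⇒_ id (⊗-unitʳ₀ Y) ≡ castWith _⇒_ id (⊗-unitʳ₀ X) ⨾ R
    σ : ∀ X Y → (X ⊗₀ Y) ⇒ (Y ⊗₀ X)
    σ-natural : ∀ {X Y X' Y'} (R : X ⇒ X') (S : Y ⇒ Y') → (R ⊗₁ S) ⨾ σ X' Y' ≡ σ X Y ⨾ (S ⊗₁ R)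
    σ-invol : ∀ X Y → σ X Y ⨾ σ Y X ≡ id (X ⊗₀ Y)
    σ-hexagon : ∀ X Y Z
              → σ (X ⊗₀ Y) Z
                ≡ castWith _⇒_ id (⊗-assoc₀ X Y Z)
                  ⨾ (id X ⊗₁ σ Y Z)
                  ⨾ castWith _⇒_ id (sym (⊗-assoc₀ X Z Y))
                  ⨾ (σ X Z ⊗₁ id Y)
                  ⨾ castWith _⇒_ id (⊗-assoc₀ Z X Y)
    δ : ∀ X → X ⇒ (X ⊗₀ X)
    ε : ∀ X → X ⇒ I
    δ-coassoc : ∀ X → δ X ⨾ (δ X ⊗₁ id X) ⨾ castWith _⇒_ id (⊗-assoc₀ X X X) ≡ δ X ⨾ (id X ⊗₁ δ X)
    δ-counitˡ : ∀ X → δ X ⨾ (ε X ⊗₁ id X) ⨾ castWith _⇒_ id (⊗-unitˡ₀ X) ≡ id X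
    δ-counitʳ : ∀ X → δ X ⨾ (id X ⊗₁ ε X) ⨾ castWith _⇒_ id (⊗-unitʳ₀ X) ≡ id X
    δ-cocomm  : ∀ X → δ X ⨾ σ X X ≡ δ X
    δ* : ∀ X → (X ⊗₀ X) ⇒ X
    ε* : ∀ X → I ⇒ X
    δ-unit   : ∀ X → id X ≤ δ X ⨾ δ* X
    δ-counit : ∀ X → δ* X ⨾ δ X ≤ id (X ⊗₀ X)
    ε-unit   : ∀ X → id X ≤ ε X ⨾ ε* X
    ε-counit : ∀ X → ε* X ⨾ ε X ≤ id I
    frobenius : ∀ X → δ* X ⨾ δ X
                ≡ (id X ⊗₁ δ X) ⨾ castWith _⇒_ id (sym (⊗-assoc₀ X X X)) ⨾ (δ* X ⊗₁ id X)
    δ-lax : ∀ {X Y} (R : X ⇒ Y) → R ⨾ δ Y ≤ δ X ⨾ (R ⊗₁ R)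
    ε-lax : ∀ {X Y} (R : X ⇒ Y) → R ⨾ ε Y ≤ ε X
    ε-⊗ : ∀ X Y → ε (X ⊗₀ Y) ≡ (ε X ⊗₁ ε Y) ⨾ castWith _⇒_ id (⊗-unitˡ₀ I)
    δ-⊗ : ∀ X Y → δ (X ⊗₀ Y)
          ≡ (δ X ⊗₁ δ Y)
            ⨾ castWith _⇒_ id (trans (⊗-assoc₀ X X (Y ⊗₀ Y))
                                (trans (cong (X ⊗₀_) (sym (⊗-assoc₀ X Y Y)))
                                       (sym (⊗-assoc₀ X (X ⊗₀ Y) Y))))
            ⨾ ((id X ⊗₁ σ X Y) ⊗₁ id Y)
            ⨾ castWith _⇒_ id (trans (⊗-assoc₀ X (Y ⊗₀ X) Y)
                                (trans (cong (X ⊗₀_) (⊗-assoc₀ Y X Y))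
                                       (sym (⊗-assoc₀ X Y (X ⊗₀ Y)))))
    ε-I : ε I ≡ id I
    δ-I : δ I ≡ castWith _⇒_ id (sym (⊗-unitˡ₀ I))

  ⟪_⟫ : ∀ {X Y} → X ≡ Y → X ⇒ Y
  ⟪ p ⟫ = castWith _⇒_ id p

  _ᵒᵖ : ∀ {X Y} → X ⇒ Y → Y ⇒ X
  _ᵒᵖ {X} {Y} R =
    ⟪ sym (⊗-unitʳ₀ Y) ⟫
    ⨾ (id Y ⊗₁ (ε* X ⨾ δ X))
    ⨾ ⟪ sym (⊗-assoc₀ Y X X) ⟫
    ⨾ ((id Y ⊗₁ R) ⊗₁ id X)
    ⨾ ((δ* Y ⨾ ε Y) ⊗₁ id X)
    ⨾ ⟪ ⊗-unitˡ₀ X ⟫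

  IsSurjective : ∀ {X Y} → X ⇒ Y → Set e
  IsSurjective {X} {Y} R = ε* Y ≤ ε* X ⨾ R

  IsMap : ∀ {X Y} → X ⇒ Y → Set e
  IsMap {X} {Y} f = (δ X ⨾ (f ⊗₁ f) ≤ f ⨾ δ Y) × (ε X ≤ f ⨾ ε Y)

  IsSurjectiveMap : ∀ {X Y} → X ⇒ Y → Set e
  IsSurjectiveMap f = IsMap f × IsSurjective f

  EnoughMaps : Set (o ⊔ ℓ ⊔ e)
  EnoughMaps = ∀ {X} (R : X ⇒ I) → Σ Obj λ Z → Σ (Z ⇒ X) λ f → IsMap f × (R ≡ (f ᵒᵖ) ⨾ ε Z)

  IsWeakPullbackInMap : ∀ {A B C D} (f : A ⇒ B) (g : A ⇒ C) (h : B ⇒ D) (k : C ⇒ D) → Set (o ⊔ ℓ ⊔ e)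
  IsWeakPullbackInMap {A} {B} {C} {D} f g h k =
    IsMap f × IsMap g × IsMap h × IsMap k × (f ⨾ h ≡ g ⨾ k)
    × (∀ {Q} (p : Q ⇒ B) (q : Q ⇒ C) → IsMap p → IsMap q → p ⨾ h ≡ q ⨾ k
       → Σ (Q ⇒ A) λ u → IsMap u × (u ⨾ f ≡ p) × (u ⨾ g ≡ q))

  IsTame : Set (o ⊔ ℓ ⊔ e)
  IsTame = EnoughMaps
    × (∀ {A B C D} (f : A ⇒ B) (g : A ⇒ C) (h : B ⇒ D) (k : C ⇒ D)
       → IsMap f → IsMap g → IsMap h → IsMap k
       → ((h ⨾ (k ᵒᵖ) ≡ (f ᵒᵖ) ⨾ g) ⇔ IsWeakPullbackInMap f g h k))

-- Surjectivity of R : X → Y is the inequality ε*_Y ≤ ε*_X ; R, and every morphism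
-- I → X lies below ε*_X; these two facts give closure under identities, composition,
-- products and left cancellation almost by monotonicity. For a weak pullback
-- f ; π = τ ; k of maps, tameness turns the square into the equation π ; k^op = f^op ; τ,
-- and since k is total we have id ≤ k ; k^op (Frobenius makes id_C lie below the cap of C
-- bent along the cup, and totality gives cap_C ≤ (k ⊗ k) ; cap_D), whence
--   ε*_C ≤ ε*_C ; k ; k^op ≤ ε*_D ; k^op ≤ ε*_B ; π ; k^op = ε*_B ; f^op ; τ ≤ ε*_A ; τ.
module Submission where

open import Defs
open import Level using (Level)
open import Data.Product using (_×_; _,_; proj₁; proj₂)
open import Relation.Binary.PropositionalEquality
  using (_≡_; refl; sym; trans; cong; cong₂; isEquivalence)
open import Relation.Binary.Bundles using (Poset)
open import Function.Bundles using (Equivalence)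
import Relation.Binary.Reasoning.PartialOrder as PosetReasoning

module CartesianBicategoryProperties {o ℓ e : Level} (𝔹 : CartesianBicategory o ℓ e) where
  open CartesianBicategory 𝔹

  hom-poset : Obj → Obj → Poset ℓ ℓ e
  hom-poset X Y = record
    { Carrier        = X ⇒ Y
    ; _≈_            = _≡_
    ; _≤_            = _≤_
    ; isPartialOrder = record
      { isPreorder = record
        { isEquivalence = isEquivalence
        ; reflexive     = λ { refl → ≤-refl }
        ; trans         = ≤-trans
        }
      ; antisym = ≤-antisym
      }
    }

  module _ {X Y : Obj} where
    open PosetReasoning (hom-poset X Y) public

  ≤-reflexive : ∀ {X Y} {R S : X ⇒ Y} → R ≡ S → R ≤ S
  ≤-reflexive refl = ≤-refl

  ⨾-monoˡ-≤ : ∀ {X Y Z} {R R' : X ⇒ Y} (S : Y ⇒ Z) → R ≤ R' → R ⨾ S ≤ R' ⨾ S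
  ⨾-monoˡ-≤ S R≤R' = ⨾-mono R≤R' ≤-refl

  ⨾-monoʳ-≤ : ∀ {X Y Z} (R : X ⇒ Y) {S S' : Y ⇒ Z} → S ≤ S' → R ⨾ S ≤ R ⨾ S'
  ⨾-monoʳ-≤ R S≤S' = ⨾-mono ≤-refl S≤S'

  id-comm : ∀ {X Y} (R : X ⇒ Y) → R ⨾ id Y ≡ id X ⨾ R
  id-comm R = trans (⨾-idʳ R) (sym (⨾-idˡ R))

  slide : ∀ {W X X' Y Z} {a : W ⇒ X} {s : X ⇒ Y} {s' : W ⇒ X'} {b : X' ⇒ Y} {t : Y ⇒ Z}
        → a ⨾ s ≡ s' ⨾ b → a ⨾ (s ⨾ t) ≡ s' ⨾ (b ⨾ t)
  slide {a = a} {s} {s'} {b} {t} as≡s'b = begin-equality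
    a ⨾ (s ⨾ t)   ≡⟨ ⨾-assoc a s t ⟨
    (a ⨾ s) ⨾ t   ≡⟨ cong (_⨾ t) as≡s'b ⟩
    (s' ⨾ b) ⨾ t  ≡⟨ ⨾-assoc s' b t ⟩
    s' ⨾ (b ⨾ t)  ∎

  ⊗-interchange-⨾ : ∀ {X Y Z X' Y' Z' W} (R : X ⇒ Y) (S : Y ⇒ Z) (R' : X' ⇒ Y') (S' : Y' ⇒ Z')
                    {T : (Z ⊗₀ Z') ⇒ W}
                  → ((R ⨾ S) ⊗₁ (R' ⨾ S')) ⨾ T ≡ (R ⊗₁ R') ⨾ ((S ⊗₁ S') ⨾ T)
  ⊗-interchange-⨾ R S R' S' {T} =
    trans (cong (_⨾ T) (⊗-interchange R S R' S')) (⨾-assoc (R ⊗₁ R') (S ⊗₁ S') T)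

  ⊗-distribˡ-⨾ : ∀ {A X Y Z} (S : X ⇒ Y) (T : Y ⇒ Z) → id A ⊗₁ (S ⨾ T) ≡ (id A ⊗₁ S) ⨾ (id A ⊗₁ T)
  ⊗-distribˡ-⨾ {A} S T = trans (cong (_⊗₁ (S ⨾ T)) (sym (⨾-idˡ (id A)))) (⊗-interchange _ _ _ _)

  ⊗-distribʳ-⨾ : ∀ {A X Y Z} (S : X ⇒ Y) (T : Y ⇒ Z) → (S ⨾ T) ⊗₁ id A ≡ (S ⊗₁ id A) ⨾ (T ⊗₁ id A)
  ⊗-distribʳ-⨾ {A} S T = trans (cong ((S ⨾ T) ⊗₁_) (sym (⨾-idˡ (id A)))) (⊗-interchange _ _ _ _)

  ⟪⟫-inverseʳ : ∀ {X Y} (p : X ≡ Y) → ⟪ p ⟫ ⨾ ⟪ sym p ⟫ ≡ id X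
  ⟪⟫-inverseʳ refl = ⨾-idˡ (id _)

  Square : ∀ {U V U' V'} → U ⇒ V → U' ⇒ V' → V ≡ V' → U ≡ U' → Set ℓ
  Square f g p q = f ⨾ ⟪ p ⟫ ≡ ⟪ q ⟫ ⨾ g

  Square-refl⇒≡ : ∀ {U V} {f g : U ⇒ V} → Square f g refl refl → f ≡ g
  Square-refl⇒≡ {f = f} {g} sq = trans (sym (⨾-idʳ f)) (trans sq (⨾-idˡ g))

  Square-sym : ∀ {U V U' V'} {f : U ⇒ V} {g : U' ⇒ V'} {p : V ≡ V'} {q : U ≡ U'}
             → Square f g p q → Square g f (sym p) (sym q)
  Square-sym {p = refl} {q = refl} sq rewrite Square-refl⇒≡ sq = id-comm _

  Square-trans : ∀ {U V U' V' U'' V''} {f : U ⇒ V} {g : U' ⇒ V'} {h : U'' ⇒ V''}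
                 {p : V ≡ V'} {q : U ≡ U'} {p' : V' ≡ V''} {q' : U' ≡ U''}
               → Square f g p q → Square g h p' q' → Square f h (trans p p') (trans q q')
  Square-trans {p = refl} {q = refl} sq sq' rewrite Square-refl⇒≡ sq = sq'

  Square-⊗ˡ : ∀ {A A' U V U' V'} (a : A ⇒ A') {f : U ⇒ V} {g : U' ⇒ V'} {p : V ≡ V'} {q : U ≡ U'}
            → Square f g p q → Square (a ⊗₁ f) (a ⊗₁ g) (cong (A' ⊗₀_) p) (cong (A ⊗₀_) q)
  Square-⊗ˡ a {p = refl} {q = refl} sq rewrite Square-refl⇒≡ sq = id-comm _

  ⊗-regroup₀ : ∀ A B C D → (A ⊗₀ B) ⊗₀ (C ⊗₀ D) ≡ (A ⊗₀ (B ⊗₀ C)) ⊗₀ D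
  ⊗-regroup₀ A B C D =
    trans (⊗-assoc₀ A B (C ⊗₀ D))
          (trans (cong (A ⊗₀_) (sym (⊗-assoc₀ B C D))) (sym (⊗-assoc₀ A (B ⊗₀ C) D)))

  ⊗-ungroup₀ : ∀ A B C D → (A ⊗₀ (B ⊗₀ C)) ⊗₀ D ≡ (A ⊗₀ B) ⊗₀ (C ⊗₀ D)
  ⊗-ungroup₀ A B C D =
    trans (⊗-assoc₀ A (B ⊗₀ C) D)
          (trans (cong (A ⊗₀_) (⊗-assoc₀ B C D)) (sym (⊗-assoc₀ A B (C ⊗₀ D))))

  ⊗-regroup₁ : ∀ {A B C D A' B' C' D'} (a : A ⇒ A') (b : B ⇒ B') (c : C ⇒ C') (d : D ⇒ D')
             → Square ((a ⊗₁ b) ⊗₁ (c ⊗₁ d)) ((a ⊗₁ (b ⊗₁ c)) ⊗₁ d)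
                      (⊗-regroup₀ A' B' C' D') (⊗-regroup₀ A B C D)
  ⊗-regroup₁ a b c d =
    Square-trans (⊗-assoc₁ a b (c ⊗₁ d))
      (Square-trans (Square-⊗ˡ a (Square-sym (⊗-assoc₁ b c d)))
                    (Square-sym (⊗-assoc₁ a (b ⊗₁ c) d)))

  ⊗-ungroup₁ : ∀ {A B C D A' B' C' D'} (a : A ⇒ A') (b : B ⇒ B') (c : C ⇒ C') (d : D ⇒ D')
             → Square ((a ⊗₁ (b ⊗₁ c)) ⊗₁ d) ((a ⊗₁ b) ⊗₁ (c ⊗₁ d))
                      (⊗-ungroup₀ A' B' C' D') (⊗-ungroup₀ A B C D)
  ⊗-ungroup₁ a b c d =
    Square-trans (⊗-assoc₁ a (b ⊗₁ c) d)
      (Square-trans (Square-⊗ˡ a (⊗-assoc₁ b c d))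
                    (Square-sym (⊗-assoc₁ a b (c ⊗₁ d))))

  -- The middle-four interchange; axiom δ-⊗ reads δ (X ⊗₀ Y) ≡ (δ X ⊗₁ δ Y) ⨾ shuffle X X Y Y.
  shuffle : ∀ A B C D → ((A ⊗₀ B) ⊗₀ (C ⊗₀ D)) ⇒ ((A ⊗₀ C) ⊗₀ (B ⊗₀ D))
  shuffle A B C D =
    ⟪ ⊗-regroup₀ A B C D ⟫ ⨾ ((id A ⊗₁ σ B C) ⊗₁ id D) ⨾ ⟪ ⊗-ungroup₀ A C B D ⟫

  σ-middle-natural : ∀ {A B C D A' B' C' D'} (a : A ⇒ A') (b : B ⇒ B') (c : C ⇒ C') (d : D ⇒ D')
                   → ((a ⊗₁ (b ⊗₁ c)) ⊗₁ d) ⨾ ((id A' ⊗₁ σ B' C') ⊗₁ id D')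
                     ≡ ((id A ⊗₁ σ B C) ⊗₁ id D) ⨾ ((a ⊗₁ (c ⊗₁ b)) ⊗₁ d)
  σ-middle-natural a b c d = begin-equality
    ((a ⊗₁ (b ⊗₁ c)) ⊗₁ d) ⨾ ((id _ ⊗₁ σ _ _) ⊗₁ id _)
      ≡⟨ ⊗-interchange _ _ _ _ ⟨
    ((a ⊗₁ (b ⊗₁ c)) ⨾ (id _ ⊗₁ σ _ _)) ⊗₁ (d ⨾ id _)
      ≡⟨ cong₂ _⊗₁_ (⊗-interchange _ _ _ _) refl ⟨
    ((a ⨾ id _) ⊗₁ ((b ⊗₁ c) ⨾ σ _ _)) ⊗₁ (d ⨾ id _)
      ≡⟨ cong₂ _⊗₁_ (cong₂ _⊗₁_ (id-comm a) (σ-natural b c)) (id-comm d) ⟩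
    ((id _ ⨾ a) ⊗₁ (σ _ _ ⨾ (c ⊗₁ b))) ⊗₁ (id _ ⨾ d)
      ≡⟨ cong₂ _⊗₁_ (⊗-interchange _ _ _ _) refl ⟩
    ((id _ ⊗₁ σ _ _) ⨾ (a ⊗₁ (c ⊗₁ b))) ⊗₁ (id _ ⨾ d)
      ≡⟨ ⊗-interchange _ _ _ _ ⟩
    ((id _ ⊗₁ σ _ _) ⊗₁ id _) ⨾ ((a ⊗₁ (c ⊗₁ b)) ⊗₁ d)
      ∎

  shuffle-natural : ∀ {A B C D A' B' C' D'} (a : A ⇒ A') (b : B ⇒ B') (c : C ⇒ C') (d : D ⇒ D')
                  → ((a ⊗₁ b) ⊗₁ (c ⊗₁ d)) ⨾ shuffle A' B' C' D'
                    ≡ shuffle A B C D ⨾ ((a ⊗₁ c) ⊗₁ (b ⊗₁ d))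
  shuffle-natural {A} {B} {C} {D} a b c d = begin-equality
    ((a ⊗₁ b) ⊗₁ (c ⊗₁ d)) ⨾ (⟪ _ ⟫ ⨾ (M' ⨾ ⟪ _ ⟫))
      ≡⟨ slide (⊗-regroup₁ a b c d) ⟩
    ⟪ regroup ⟫ ⨾ (((a ⊗₁ (b ⊗₁ c)) ⊗₁ d) ⨾ (M' ⨾ ⟪ _ ⟫))
      ≡⟨ cong (⟪ regroup ⟫ ⨾_) (slide (σ-middle-natural a b c d)) ⟩
    ⟪ regroup ⟫ ⨾ (M ⨾ (((a ⊗₁ (c ⊗₁ b)) ⊗₁ d) ⨾ ⟪ _ ⟫))
      ≡⟨ cong (λ z → ⟪ regroup ⟫ ⨾ (M ⨾ z)) (⊗-ungroup₁ a c b d) ⟩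
    ⟪ regroup ⟫ ⨾ (M ⨾ (⟪ ungroup ⟫ ⨾ ((a ⊗₁ c) ⊗₁ (b ⊗₁ d))))
      ≡⟨ trans (cong (⟪ regroup ⟫ ⨾_) (sym (⨾-assoc _ _ _))) (sym (⨾-assoc _ _ _)) ⟩
    shuffle A B C D ⨾ ((a ⊗₁ c) ⊗₁ (b ⊗₁ d))
      ∎
    where
    regroup = ⊗-regroup₀ A B C D
    ungroup = ⊗-ungroup₀ A C B D
    M = (id A ⊗₁ σ B C) ⊗₁ id D
    M' = (id _ ⊗₁ σ _ _) ⊗₁ id _

  id-isMap : ∀ X → IsMap (id X)
  id-isMap X = ≤-reflexive (begin-equality
                 δ X ⨾ (id X ⊗₁ id X) ≡⟨ cong (δ X ⨾_) (⊗-id X X) ⟩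
                 δ X ⨾ id (X ⊗₀ X)    ≡⟨ id-comm (δ X) ⟩
                 id X ⨾ δ X           ∎)
             , ≤-reflexive (sym (⨾-idˡ (ε X)))

  ⨾-isMap : ∀ {X Y Z} {f : X ⇒ Y} {g : Y ⇒ Z} → IsMap f → IsMap g → IsMap (f ⨾ g)
  ⨾-isMap {X} {Y} {Z} {f} {g} (f-δ , f-ε) (g-δ , g-ε) = comult , counit
    where
    comult : δ X ⨾ ((f ⨾ g) ⊗₁ (f ⨾ g)) ≤ (f ⨾ g) ⨾ δ Z
    comult = begin
      δ X ⨾ ((f ⨾ g) ⊗₁ (f ⨾ g)) ≡⟨ cong (δ X ⨾_) (⊗-interchange f g f g) ⟩
      δ X ⨾ ((f ⊗₁ f) ⨾ (g ⊗₁ g)) ≡⟨ ⨾-assoc _ _ _ ⟨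
      (δ X ⨾ (f ⊗₁ f)) ⨾ (g ⊗₁ g) ≤⟨ ⨾-monoˡ-≤ _ f-δ ⟩
      (f ⨾ δ Y) ⨾ (g ⊗₁ g)        ≡⟨ ⨾-assoc _ _ _ ⟩
      f ⨾ (δ Y ⨾ (g ⊗₁ g))        ≤⟨ ⨾-monoʳ-≤ f g-δ ⟩
      f ⨾ (g ⨾ δ Z)               ≡⟨ ⨾-assoc _ _ _ ⟨
      (f ⨾ g) ⨾ δ Z               ∎
    counit : ε X ≤ (f ⨾ g) ⨾ ε Z
    counit = begin
      ε X           ≤⟨ f-ε ⟩
      f ⨾ ε Y       ≤⟨ ⨾-monoʳ-≤ f g-ε ⟩
      f ⨾ (g ⨾ ε Z) ≡⟨ ⨾-assoc _ _ _ ⟨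
      (f ⨾ g) ⨾ ε Z ∎

  ⊗-isMap : ∀ {X X' Y Y'} {f : X ⇒ Y} {g : X' ⇒ Y'} → IsMap f → IsMap g → IsMap (f ⊗₁ g)
  ⊗-isMap {X} {X'} {Y} {Y'} {f} {g} (f-δ , f-ε) (g-δ , g-ε) = comult , counit
    where
    comult : δ (X ⊗₀ X') ⨾ ((f ⊗₁ g) ⊗₁ (f ⊗₁ g)) ≤ (f ⊗₁ g) ⨾ δ (Y ⊗₀ Y')
    comult = begin
      δ (X ⊗₀ X') ⨾ ((f ⊗₁ g) ⊗₁ (f ⊗₁ g))
        ≡⟨ trans (cong (_⨾ _) (δ-⊗ X X')) (⨾-assoc _ _ _) ⟩
      (δ X ⊗₁ δ X') ⨾ (shuffle X X X' X' ⨾ ((f ⊗₁ g) ⊗₁ (f ⊗₁ g)))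
        ≡⟨ cong ((δ X ⊗₁ δ X') ⨾_) (shuffle-natural f f g g) ⟨
      (δ X ⊗₁ δ X') ⨾ (((f ⊗₁ f) ⊗₁ (g ⊗₁ g)) ⨾ shuffle Y Y Y' Y')
        ≡⟨ ⊗-interchange-⨾ (δ X) (f ⊗₁ f) (δ X') (g ⊗₁ g) ⟨
      ((δ X ⨾ (f ⊗₁ f)) ⊗₁ (δ X' ⨾ (g ⊗₁ g))) ⨾ shuffle Y Y Y' Y'
        ≤⟨ ⨾-monoˡ-≤ _ (⊗-mono f-δ g-δ) ⟩
      ((f ⨾ δ Y) ⊗₁ (g ⨾ δ Y')) ⨾ shuffle Y Y Y' Y'
        ≡⟨ ⊗-interchange-⨾ f (δ Y) g (δ Y') ⟩
      (f ⊗₁ g) ⨾ ((δ Y ⊗₁ δ Y') ⨾ shuffle Y Y Y' Y')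
        ≡⟨ cong ((f ⊗₁ g) ⨾_) (δ-⊗ Y Y') ⟨
      (f ⊗₁ g) ⨾ δ (Y ⊗₀ Y')
        ∎
    counit : ε (X ⊗₀ X') ≤ (f ⊗₁ g) ⨾ ε (Y ⊗₀ Y')
    counit = begin
      ε (X ⊗₀ X')                                   ≡⟨ ε-⊗ X X' ⟩
      (ε X ⊗₁ ε X') ⨾ ⟪ ⊗-unitˡ₀ I ⟫                ≤⟨ ⨾-monoˡ-≤ _ (⊗-mono f-ε g-ε) ⟩
      ((f ⨾ ε Y) ⊗₁ (g ⨾ ε Y')) ⨾ ⟪ ⊗-unitˡ₀ I ⟫    ≡⟨ ⊗-interchange-⨾ f (ε Y) g (ε Y') ⟩
      (f ⊗₁ g) ⨾ ((ε Y ⊗₁ ε Y') ⨾ ⟪ ⊗-unitˡ₀ I ⟫)   ≡⟨ cong ((f ⊗₁ g) ⨾_) (ε-⊗ Y Y') ⟨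
      (f ⊗₁ g) ⨾ ε (Y ⊗₀ Y')                        ∎

  ≤ε* : ∀ {X} (S : I ⇒ X) → S ≤ ε* X
  ≤ε* {X} S = begin
    S                  ≡⟨ ⨾-idʳ S ⟨
    S ⨾ id X           ≤⟨ ⨾-monoʳ-≤ S (ε-unit X) ⟩
    S ⨾ (ε X ⨾ ε* X)   ≡⟨ ⨾-assoc _ _ _ ⟨
    (S ⨾ ε X) ⨾ ε* X   ≤⟨ ⨾-monoˡ-≤ _ (ε-lax S) ⟩
    ε I ⨾ ε* X         ≡⟨ cong (_⨾ ε* X) ε-I ⟩
    id I ⨾ ε* X        ≡⟨ ⨾-idˡ _ ⟩
    ε* X               ∎

  ε*≤ : ∀ {X} {S : I ⇒ X} → id X ≤ ε X ⨾ S → ε* X ≤ S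
  ε*≤ {X} {S} id≤εS = begin
    ε* X                  ≡⟨ ⨾-idʳ _ ⟨
    ε* X ⨾ id X           ≤⟨ ⨾-monoʳ-≤ _ id≤εS ⟩
    ε* X ⨾ (ε X ⨾ S)      ≡⟨ ⨾-assoc _ _ _ ⟨
    (ε* X ⨾ ε X) ⨾ S      ≤⟨ ⨾-monoˡ-≤ S (ε-counit X) ⟩
    id I ⨾ S              ≡⟨ ⨾-idˡ S ⟩
    S                     ∎

  ε*-⊗ : ∀ X Y → ε* (X ⊗₀ Y) ≡ ⟪ sym (⊗-unitˡ₀ I) ⟫ ⨾ (ε* X ⊗₁ ε* Y)
  ε*-⊗ X Y = ≤-antisym (ε*≤ id≤ε⨾ε*⊗ε*) (≤ε* _)
    where
    ε-⊗-untwisted : ε (X ⊗₀ Y) ⨾ ⟪ sym (⊗-unitˡ₀ I) ⟫ ≡ ε X ⊗₁ ε Y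
    ε-⊗-untwisted = begin-equality
      ε (X ⊗₀ Y) ⨾ ⟪ sym (⊗-unitˡ₀ I) ⟫
        ≡⟨ trans (cong (_⨾ _) (ε-⊗ X Y)) (⨾-assoc _ _ _) ⟩
      (ε X ⊗₁ ε Y) ⨾ (⟪ ⊗-unitˡ₀ I ⟫ ⨾ ⟪ sym (⊗-unitˡ₀ I) ⟫)
        ≡⟨ cong ((ε X ⊗₁ ε Y) ⨾_) (⟪⟫-inverseʳ (⊗-unitˡ₀ I)) ⟩
      (ε X ⊗₁ ε Y) ⨾ id (I ⊗₀ I)
        ≡⟨ ⨾-idʳ _ ⟩
      ε X ⊗₁ ε Y
        ∎
    id≤ε⨾ε*⊗ε* : id (X ⊗₀ Y) ≤ ε (X ⊗₀ Y) ⨾ (⟪ sym (⊗-unitˡ₀ I) ⟫ ⨾ (ε* X ⊗₁ ε* Y))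
    id≤ε⨾ε*⊗ε* = begin
      id (X ⊗₀ Y)                                        ≡⟨ ⊗-id X Y ⟨
      id X ⊗₁ id Y                                       ≤⟨ ⊗-mono (ε-unit X) (ε-unit Y) ⟩
      (ε X ⨾ ε* X) ⊗₁ (ε Y ⨾ ε* Y)                       ≡⟨ ⊗-interchange _ _ _ _ ⟩
      (ε X ⊗₁ ε Y) ⨾ (ε* X ⊗₁ ε* Y)                      ≡⟨ cong (_⨾ _) ε-⊗-untwisted ⟨
      (ε (X ⊗₀ Y) ⨾ ⟪ sym (⊗-unitˡ₀ I) ⟫) ⨾ (ε* X ⊗₁ ε* Y) ≡⟨ ⨾-assoc _ _ _ ⟩
      ε (X ⊗₀ Y) ⨾ (⟪ sym (⊗-unitˡ₀ I) ⟫ ⨾ (ε* X ⊗₁ ε* Y)) ∎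

  id-isSurjective : ∀ X → IsSurjective (id X)
  id-isSurjective X = ≤-reflexive (sym (⨾-idʳ (ε* X)))

  ⨾-isSurjective : ∀ {X Y Z} {f : X ⇒ Y} {g : Y ⇒ Z} → IsSurjective f → IsSurjective g → IsSurjective (f ⨾ g)
  ⨾-isSurjective {X} {Y} {Z} {f} {g} f-surj g-surj = begin
    ε* Z             ≤⟨ g-surj ⟩
    ε* Y ⨾ g         ≤⟨ ⨾-monoˡ-≤ g f-surj ⟩
    (ε* X ⨾ f) ⨾ g   ≡⟨ ⨾-assoc _ _ _ ⟩
    ε* X ⨾ (f ⨾ g)   ∎

  ⊗-isSurjective : ∀ {X X' Y Y'} {f : X ⇒ Y} {g : X' ⇒ Y'} → IsSurjective f → IsSurjective g → IsSurjective (f ⊗₁ g)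
  ⊗-isSurjective {X} {X'} {Y} {Y'} {f} {g} f-surj g-surj = begin
    ε* (Y ⊗₀ Y')                                    ≡⟨ ε*-⊗ Y Y' ⟩
    unitor ⨾ (ε* Y ⊗₁ ε* Y')                        ≤⟨ ⨾-monoʳ-≤ unitor (⊗-mono f-surj g-surj) ⟩
    unitor ⨾ ((ε* X ⨾ f) ⊗₁ (ε* X' ⨾ g))            ≡⟨ cong (unitor ⨾_) (⊗-interchange _ _ _ _) ⟩
    unitor ⨾ ((ε* X ⊗₁ ε* X') ⨾ (f ⊗₁ g))           ≡⟨ ⨾-assoc _ _ _ ⟨
    (unitor ⨾ (ε* X ⊗₁ ε* X')) ⨾ (f ⊗₁ g)           ≡⟨ cong (_⨾ (f ⊗₁ g)) (ε*-⊗ X X') ⟨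
    ε* (X ⊗₀ X') ⨾ (f ⊗₁ g)                         ∎
    where unitor = ⟪ sym (⊗-unitˡ₀ I) ⟫

  isSurjective-cancelˡ : ∀ {X Y Z} (f : X ⇒ Y) {π : Y ⇒ Z} → IsSurjective (f ⨾ π) → IsSurjective π
  isSurjective-cancelˡ {X} {Y} {Z} f {π} fπ-surj = begin
    ε* Z             ≤⟨ fπ-surj ⟩
    ε* X ⨾ (f ⨾ π)   ≡⟨ ⨾-assoc _ _ _ ⟨
    (ε* X ⨾ f) ⨾ π   ≤⟨ ⨾-monoˡ-≤ π (≤ε* _) ⟩
    ε* Y ⨾ π         ∎

  δ*-lax : ∀ {X Y} (R : X ⇒ Y) → δ* X ⨾ R ≤ (R ⊗₁ R) ⨾ δ* Y
  δ*-lax {X} {Y} R = begin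
    δ* X ⨾ R                          ≡⟨ ⨾-idʳ _ ⟨
    (δ* X ⨾ R) ⨾ id Y                 ≤⟨ ⨾-monoʳ-≤ _ (δ-unit Y) ⟩
    (δ* X ⨾ R) ⨾ (δ Y ⨾ δ* Y)         ≡⟨ trans (⨾-assoc _ _ _) (cong (δ* X ⨾_) (sym (⨾-assoc _ _ _))) ⟩
    δ* X ⨾ ((R ⨾ δ Y) ⨾ δ* Y)         ≤⟨ ⨾-monoʳ-≤ _ (⨾-monoˡ-≤ _ (δ-lax R)) ⟩
    δ* X ⨾ ((δ X ⨾ (R ⊗₁ R)) ⨾ δ* Y)  ≡⟨ trans (cong (δ* X ⨾_) (⨾-assoc _ _ _)) (sym (⨾-assoc _ _ _)) ⟩
    (δ* X ⨾ δ X) ⨾ ((R ⊗₁ R) ⨾ δ* Y)  ≤⟨ ⨾-monoˡ-≤ _ (δ-counit X) ⟩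
    id (X ⊗₀ X) ⨾ ((R ⊗₁ R) ⨾ δ* Y)   ≡⟨ ⨾-idˡ _ ⟩
    (R ⊗₁ R) ⨾ δ* Y                   ∎

  cap : ∀ X → (X ⊗₀ X) ⇒ I
  cap X = δ* X ⨾ ε X

  cup : ∀ X → I ⇒ (X ⊗₀ X)
  cup X = ε* X ⨾ δ X

  cap-lax : ∀ {X Y} {R : X ⇒ Y} → ε X ≤ R ⨾ ε Y → cap X ≤ (R ⊗₁ R) ⨾ cap Y
  cap-lax {X} {Y} {R} R-total = begin
    δ* X ⨾ ε X               ≤⟨ ⨾-monoʳ-≤ _ R-total ⟩
    δ* X ⨾ (R ⨾ ε Y)         ≡⟨ ⨾-assoc _ _ _ ⟨
    (δ* X ⨾ R) ⨾ ε Y         ≤⟨ ⨾-monoˡ-≤ _ (δ*-lax R) ⟩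
    ((R ⊗₁ R) ⨾ δ* Y) ⨾ ε Y  ≡⟨ ⨾-assoc _ _ _ ⟩
    (R ⊗₁ R) ⨾ cap Y         ∎

  -- The morphism A ⇒ C that Q : A ⊗₀ C ⇒ I names under the compact closed structure.
  bend : ∀ {A C} → (A ⊗₀ C) ⇒ I → A ⇒ C
  bend {A} {C} Q =
    ⟪ sym (⊗-unitʳ₀ A) ⟫ ⨾ (id A ⊗₁ cup C) ⨾ ⟪ sym (⊗-assoc₀ A C C) ⟫ ⨾ (Q ⊗₁ id C) ⨾ ⟪ ⊗-unitˡ₀ C ⟫

  bend-mono : ∀ {A C} {Q Q' : (A ⊗₀ C) ⇒ I} → Q ≤ Q' → bend Q ≤ bend Q'
  bend-mono Q≤Q' = ⨾-monoʳ-≤ _ (⨾-monoʳ-≤ _ (⨾-monoʳ-≤ _ (⨾-monoˡ-≤ _ (⊗-mono Q≤Q' ≤-refl))))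

  ᵒᵖ-bend : ∀ {X Y} (R : X ⇒ Y) → R ᵒᵖ ≡ bend ((id Y ⊗₁ R) ⨾ cap Y)
  ᵒᵖ-bend {X} {Y} R = cong (λ z → ⟪ _ ⟫ ⨾ (id Y ⊗₁ cup X) ⨾ ⟪ _ ⟫ ⨾ z) (begin-equality
    ((id Y ⊗₁ R) ⊗₁ id X) ⨾ (cap Y ⊗₁ id X) ⨾ ⟪ ⊗-unitˡ₀ X ⟫
      ≡⟨ ⊗-interchange-⨾ (id Y ⊗₁ R) (cap Y) (id X) (id X) ⟨
    ((id Y ⊗₁ R) ⨾ cap Y) ⊗₁ (id X ⨾ id X) ⨾ ⟪ ⊗-unitˡ₀ X ⟫
      ≡⟨ cong (λ z → (((id Y ⊗₁ R) ⨾ cap Y) ⊗₁ z) ⨾ ⟪ ⊗-unitˡ₀ X ⟫) (⨾-idˡ (id X)) ⟩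
    (((id Y ⊗₁ R) ⨾ cap Y) ⊗₁ id X) ⨾ ⟪ ⊗-unitˡ₀ X ⟫
      ∎)

  bend-natural : ∀ {A' A C} (k : A' ⇒ A) (Q : (A ⊗₀ C) ⇒ I) → k ⨾ bend Q ≡ bend ((k ⊗₁ id C) ⨾ Q)
  bend-natural {A'} {A} {C} k Q = begin-equality
    k ⨾ (⟪ sym (⊗-unitʳ₀ A) ⟫ ⨾ (id A ⊗₁ cup C) ⨾ rest)
      ≡⟨ slide (Square-sym (⊗-unitʳ₁ k)) ⟩
    ⟪ sym (⊗-unitʳ₀ A') ⟫ ⨾ (k ⊗₁ id I) ⨾ (id A ⊗₁ cup C) ⨾ rest
      ≡⟨ cong (⟪ _ ⟫ ⨾_) (slide cup-slides-past-k) ⟩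
    ⟪ sym (⊗-unitʳ₀ A') ⟫ ⨾ (id A' ⊗₁ cup C) ⨾ (k ⊗₁ (id C ⊗₁ id C)) ⨾ ⟪ sym (⊗-assoc₀ A C C) ⟫ ⨾ tail
      ≡⟨ cong (λ z → ⟪ _ ⟫ ⨾ (id A' ⊗₁ cup C) ⨾ z) (slide (Square-sym (⊗-assoc₁ k (id C) (id C)))) ⟩
    ⟪ sym (⊗-unitʳ₀ A') ⟫ ⨾ (id A' ⊗₁ cup C) ⨾ ⟪ sym (⊗-assoc₀ A' C C) ⟫ ⨾ ((k ⊗₁ id C) ⊗₁ id C) ⨾ tail
      ≡⟨ cong (λ z → ⟪ _ ⟫ ⨾ (id A' ⊗₁ cup C) ⨾ ⟪ _ ⟫ ⨾ z) (sym (trans (cong (_⨾ ⟪ ⊗-unitˡ₀ C ⟫) (⊗-distribʳ-⨾ (k ⊗₁ id C) Q)) (⨾-assoc _ _ _))) ⟩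
    bend ((k ⊗₁ id C) ⨾ Q)
      ∎
    where
    tail = (Q ⊗₁ id C) ⨾ ⟪ ⊗-unitˡ₀ C ⟫
    rest = ⟪ sym (⊗-assoc₀ A C C) ⟫ ⨾ tail
    cup-slides-past-k : (k ⊗₁ id I) ⨾ (id A ⊗₁ cup C) ≡ (id A' ⊗₁ cup C) ⨾ (k ⊗₁ (id C ⊗₁ id C))
    cup-slides-past-k = begin-equality
      (k ⊗₁ id I) ⨾ (id A ⊗₁ cup C)              ≡⟨ ⊗-interchange _ _ _ _ ⟨
      (k ⨾ id A) ⊗₁ (id I ⨾ cup C)              ≡⟨ cong₂ _⊗₁_ (id-comm k) (sym (id-comm (cup C))) ⟩
      (id A' ⨾ k) ⊗₁ (cup C ⨾ id (C ⊗₀ C))      ≡⟨ cong (λ z → (id A' ⨾ k) ⊗₁ (cup C ⨾ z)) (⊗-id C C) ⟨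
      (id A' ⨾ k) ⊗₁ (cup C ⨾ (id C ⊗₁ id C))   ≡⟨ ⊗-interchange _ _ _ _ ⟩
      (id A' ⊗₁ cup C) ⨾ (k ⊗₁ (id C ⊗₁ id C))  ∎

  δ⨾id⊗ε : ∀ X → δ X ⨾ (id X ⊗₁ ε X) ≡ ⟪ sym (⊗-unitʳ₀ X) ⟫
  δ⨾id⊗ε X = begin-equality
    δ X ⨾ (id X ⊗₁ ε X)                                    ≡⟨ ⨾-idʳ _ ⟨
    (δ X ⨾ (id X ⊗₁ ε X)) ⨾ id (X ⊗₀ I)                    ≡⟨ cong ((δ X ⨾ (id X ⊗₁ ε X)) ⨾_) (⟪⟫-inverseʳ (⊗-unitʳ₀ X)) ⟨
    (δ X ⨾ (id X ⊗₁ ε X)) ⨾ (⟪ ⊗-unitʳ₀ X ⟫ ⨾ ⟪ sym (⊗-unitʳ₀ X) ⟫)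
      ≡⟨ trans (⨾-assoc _ _ _) (cong (δ X ⨾_) (sym (⨾-assoc _ _ _))) ⟩
    δ X ⨾ ((id X ⊗₁ ε X) ⨾ ⟪ ⊗-unitʳ₀ X ⟫) ⨾ ⟪ sym (⊗-unitʳ₀ X) ⟫
      ≡⟨ sym (⨾-assoc _ _ _) ⟩
    (δ X ⨾ (id X ⊗₁ ε X) ⨾ ⟪ ⊗-unitʳ₀ X ⟫) ⨾ ⟪ sym (⊗-unitʳ₀ X) ⟫
      ≡⟨ cong (_⨾ _) (δ-counitʳ X) ⟩
    id X ⨾ ⟪ sym (⊗-unitʳ₀ X) ⟫                            ≡⟨ ⨾-idˡ _ ⟩
    ⟪ sym (⊗-unitʳ₀ X) ⟫                                   ∎

  bend-cap : ∀ X → bend (cap X) ≡ ⟪ sym (⊗-unitʳ₀ X) ⟫ ⨾ (id X ⊗₁ ε* X) ⨾ δ* X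
  bend-cap X = cong (⟪ sym (⊗-unitʳ₀ X) ⟫ ⨾_) (begin-equality
    (id X ⊗₁ (ε* X ⨾ δ X)) ⨾ assoc ⨾ ((δ* X ⨾ ε X) ⊗₁ id X) ⨾ ⟪ ⊗-unitˡ₀ X ⟫
      ≡⟨ cong₂ (λ u v → u ⨾ assoc ⨾ v ⨾ ⟪ ⊗-unitˡ₀ X ⟫) (⊗-distribˡ-⨾ (ε* X) (δ X)) (⊗-distribʳ-⨾ (δ* X) (ε X)) ⟩
    ((id X ⊗₁ ε* X) ⨾ (id X ⊗₁ δ X)) ⨾ assoc ⨾ ((δ* X ⊗₁ id X) ⨾ (ε X ⊗₁ id X)) ⨾ ⟪ ⊗-unitˡ₀ X ⟫
      ≡⟨ ⨾-assoc _ _ _ ⟩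
    (id X ⊗₁ ε* X) ⨾ (id X ⊗₁ δ X) ⨾ assoc ⨾ ((δ* X ⊗₁ id X) ⨾ (ε X ⊗₁ id X)) ⨾ ⟪ ⊗-unitˡ₀ X ⟫
      ≡⟨ cong ((id X ⊗₁ ε* X) ⨾_) frobenius-then-counit ⟩
    (id X ⊗₁ ε* X) ⨾ δ* X
      ∎)
    where
    assoc = ⟪ sym (⊗-assoc₀ X X X) ⟫
    frobenius-then-counit :
      (id X ⊗₁ δ X) ⨾ assoc ⨾ ((δ* X ⊗₁ id X) ⨾ (ε X ⊗₁ id X)) ⨾ ⟪ ⊗-unitˡ₀ X ⟫ ≡ δ* X
    frobenius-then-counit = begin-equality
      (id X ⊗₁ δ X) ⨾ assoc ⨾ ((δ* X ⊗₁ id X) ⨾ (ε X ⊗₁ id X)) ⨾ ⟪ ⊗-unitˡ₀ X ⟫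
        ≡⟨ cong (λ z → (id X ⊗₁ δ X) ⨾ assoc ⨾ z) (⨾-assoc _ _ _) ⟩
      (id X ⊗₁ δ X) ⨾ assoc ⨾ (δ* X ⊗₁ id X) ⨾ (ε X ⊗₁ id X) ⨾ ⟪ ⊗-unitˡ₀ X ⟫
        ≡⟨ trans (cong ((id X ⊗₁ δ X) ⨾_) (sym (⨾-assoc _ _ _))) (sym (⨾-assoc _ _ _)) ⟩
      ((id X ⊗₁ δ X) ⨾ assoc ⨾ (δ* X ⊗₁ id X)) ⨾ (ε X ⊗₁ id X) ⨾ ⟪ ⊗-unitˡ₀ X ⟫
        ≡⟨ cong (_⨾ (ε X ⊗₁ id X) ⨾ ⟪ ⊗-unitˡ₀ X ⟫) (frobenius X) ⟨
      (δ* X ⨾ δ X) ⨾ (ε X ⊗₁ id X) ⨾ ⟪ ⊗-unitˡ₀ X ⟫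
        ≡⟨ trans (⨾-assoc _ _ _) (cong (δ* X ⨾_) (δ-counitˡ X)) ⟩
      δ* X ⨾ id X
        ≡⟨ ⨾-idʳ _ ⟩
      δ* X
        ∎

  id≤bend-cap : ∀ X → id X ≤ bend (cap X)
  id≤bend-cap X = begin
    id X                                                 ≤⟨ δ-unit X ⟩
    δ X ⨾ δ* X                                           ≡⟨ cong (_⨾ δ* X) (trans (sym (⨾-idʳ _)) (cong (δ X ⨾_) (sym (⊗-id X X)))) ⟩
    (δ X ⨾ (id X ⊗₁ id X)) ⨾ δ* X                        ≤⟨ ⨾-monoˡ-≤ _ (⨾-monoʳ-≤ _ (⊗-mono ≤-refl (ε-unit X))) ⟩
    (δ X ⨾ (id X ⊗₁ (ε X ⨾ ε* X))) ⨾ δ* X                ≡⟨ cong (λ z → (δ X ⨾ z) ⨾ δ* X) (⊗-distribˡ-⨾ (ε X) (ε* X)) ⟩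
    (δ X ⨾ (id X ⊗₁ ε X) ⨾ (id X ⊗₁ ε* X)) ⨾ δ* X        ≡⟨ trans (cong (_⨾ δ* X) (sym (⨾-assoc _ _ _))) (⨾-assoc _ _ _) ⟩
    (δ X ⨾ (id X ⊗₁ ε X)) ⨾ (id X ⊗₁ ε* X) ⨾ δ* X        ≡⟨ cong (_⨾ _) (δ⨾id⊗ε X) ⟩
    ⟪ sym (⊗-unitʳ₀ X) ⟫ ⨾ (id X ⊗₁ ε* X) ⨾ δ* X         ≡⟨ bend-cap X ⟨
    bend (cap X)                                         ∎

  id≤⨾ᵒᵖ : ∀ {X Y} {R : X ⇒ Y} → ε X ≤ R ⨾ ε Y → id X ≤ R ⨾ R ᵒᵖ
  id≤⨾ᵒᵖ {X} {Y} {R} R-total = begin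
    id X                                           ≤⟨ id≤bend-cap X ⟩
    bend (cap X)                                   ≤⟨ bend-mono (cap-lax R-total) ⟩
    bend ((R ⊗₁ R) ⨾ cap Y)                        ≡⟨ cong bend split ⟩
    bend ((R ⊗₁ id X) ⨾ (id Y ⊗₁ R) ⨾ cap Y)       ≡⟨ bend-natural R _ ⟨
    R ⨾ bend ((id Y ⊗₁ R) ⨾ cap Y)                 ≡⟨ cong (R ⨾_) (ᵒᵖ-bend R) ⟨
    R ⨾ R ᵒᵖ                                       ∎
    where
    split : (R ⊗₁ R) ⨾ cap Y ≡ (R ⊗₁ id X) ⨾ (id Y ⊗₁ R) ⨾ cap Y
    split = trans (cong (_⨾ cap Y) (trans (cong₂ _⊗₁_ (sym (⨾-idʳ R)) (sym (⨾-idˡ R))) (⊗-interchange _ _ _ _)))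
                  (⨾-assoc _ _ _)

  isSurjective-transfer : ∀ {A B C D} {f : A ⇒ B} {π : B ⇒ D} {τ : A ⇒ C} {k : C ⇒ D}
                        → ε C ≤ k ⨾ ε D → π ⨾ k ᵒᵖ ≡ f ᵒᵖ ⨾ τ → IsSurjective π → IsSurjective τ
  isSurjective-transfer {A} {B} {C} {D} {f} {π} {τ} {k} k-total πkᵒᵖ≡fᵒᵖτ π-surj = begin
    ε* C                   ≡⟨ ⨾-idʳ _ ⟨
    ε* C ⨾ id C            ≤⟨ ⨾-monoʳ-≤ _ (id≤⨾ᵒᵖ k-total) ⟩
    ε* C ⨾ k ⨾ k ᵒᵖ        ≡⟨ ⨾-assoc _ _ _ ⟨
    (ε* C ⨾ k) ⨾ k ᵒᵖ      ≤⟨ ⨾-monoˡ-≤ _ (≤ε* _) ⟩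
    ε* D ⨾ k ᵒᵖ            ≤⟨ ⨾-monoˡ-≤ _ π-surj ⟩
    (ε* B ⨾ π) ⨾ k ᵒᵖ      ≡⟨ trans (⨾-assoc _ _ _) (cong (ε* B ⨾_) πkᵒᵖ≡fᵒᵖτ) ⟩
    ε* B ⨾ f ᵒᵖ ⨾ τ        ≡⟨ ⨾-assoc _ _ _ ⟨
    (ε* B ⨾ f ᵒᵖ) ⨾ τ      ≤⟨ ⨾-monoˡ-≤ _ (≤ε* _) ⟩
    ε* A ⨾ τ               ∎

  weakPullback-isSurjective : IsTame → ∀ {A B C D} {f : A ⇒ B} {π : B ⇒ D} {τ : A ⇒ C} {k : C ⇒ D}
                            → IsWeakPullbackInMap f τ π k → IsSurjective π → IsSurjective τ
  weakPullback-isSurjective (_ , tame) {f = f} {π} {τ} {k} wp@(f-map , τ-map , π-map , k-map , _) =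
    isSurjective-transfer (proj₂ k-map) (Equivalence.from (tame f τ π k f-map τ-map π-map k-map) wp)

proposition6p9 : ∀ {o ℓ e : Level} (𝔹 : CartesianBicategory o ℓ e)
    → CartesianBicategory.IsTame 𝔹
    → let open CartesianBicategory 𝔹 in
      (∀ X → IsSurjectiveMap (id X))
      × (∀ {X Y Z} (f : X ⇒ Y) (g : Y ⇒ Z) → IsSurjectiveMap f → IsSurjectiveMap g → IsSurjectiveMap (f ⨾ g))
      × (∀ {X Y X' Y'} (π₁ : X ⇒ Y) (π₂ : X' ⇒ Y') → IsSurjectiveMap π₁ → IsSurjectiveMap π₂ → IsSurjectiveMap (π₁ ⊗₁ π₂))
      × (∀ {A B C D} (f : A ⇒ B) (π : B ⇒ D) (τ : A ⇒ C) (k : C ⇒ D)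
         → IsWeakPullbackInMap f τ π k → IsSurjectiveMap π → IsSurjectiveMap τ)
      × (∀ {X Y Z} (f : X ⇒ Y) (π : Y ⇒ Z) → IsMap f → IsMap π → IsSurjectiveMap (f ⨾ π) → IsSurjectiveMap π)
proposition6p9 𝔹 tame =
    (λ X → id-isMap X , id-isSurjective X)
  , (λ _ _ (f-map , f-surj) (g-map , g-surj) → ⨾-isMap f-map g-map , ⨾-isSurjective f-surj g-surj)
  , (λ _ _ (π₁-map , π₁-surj) (π₂-map , π₂-surj) → ⊗-isMap π₁-map π₂-map , ⊗-isSurjective π₁-surj π₂-surj)
  , (λ _ _ _ _ wp (_ , π-surj) → proj₁ (proj₂ wp) , weakPullback-isSurjective tame wp π-surj)
  , (λ f π _ π-map (_ , fπ-surj) → π-map , isSurjective-cancelˡ f fπ-surj)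
  where open CartesianBicategoryProperties 𝔹
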